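{- Let $\mathcal{M}$ be the set of all run-constrained binary strings, and let $\mathcal{M}^l=\bigcup_{n\ge 0}\{s00: s\in V(\mathcal{R}_n^l)\}$. Then $$\mathcal{M}^l=(0\mathcal{M}\setminus\{0\})\cup\big((\mathcal{M}0\setminus\{0\})\setminus 0\mathcal{M}0\big),$$ and the two sets in this union are disjoint.
   Context: Binary strings and hypercube. For $n\ge 0$ let $\mathcal{B}_n$ be the set of binary strings of length $n$. The hypercube $Q_n$ has vertex set $\mathcal{B}_n$, and two strings are adjacent iff they differ in exactly one position. Run-constrained strings. A run in a binary string is a maximal substring of equal bits. A binary string is run-constrained if every run of 1s is immediately followed by a strictly longer run of 0s; the empty string and the string $0$ are run-constrained. A binary string is circular-run-constrained if every run of 1s is immediately followed, reading the string circularly, by a strictly longer run of 0s. Lucas-run graph. $\mathcal{R}_n^l$ is the subgraph of $Q_n$ induced by $\{s\in\mathcal{B}_n : s0\text{ circular-run-constrained and } s00 \text{ run-constrained}\}$. Notation for sets of strings. For a set $F$ of binary strings, $0F=\{0s: s\in F\}$, $F0=\{s0:s\in F\}$ and $0F0=\{0s0: s\in F\}$. -}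

module Defs where

open import Level using (0ℓ)
open import Data.Bool using (Bool; true; false; _∧_; if_then_else_)
open import Data.Bool.Properties using () renaming (_≟_ to _≟ᵇ_)
open import Data.Nat using (ℕ; zero; suc; _+_; _<_)
open import Data.List using (List; []; _∷_; _++_; length; [_])
open import Data.Product using (_×_; Σ; ∃; ∃-syntax; _,_)
open import Data.Unit using (⊤)
open import Data.Empty using (⊥)
open import Relation.Nullary using (yes; no)
open import Relation.Binary.PropositionalEquality using (_≡_)
open import Relation.Unary using (Pred; _∈_)

-- Binary strings: lists of bits, with false = 0 and true = 1.
BinStr : Set
BinStr = List Bool

Run : Set
Run = Bool × ℕ

consRun : Bool → List Run → List Run
consRun b [] = (b , 1) ∷ []
consRun b ((c , k) ∷ r) with b ≟ᵇ c
... | yes _ = (c , suc k) ∷ r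
... | no  _ = (b , 1) ∷ (c , k) ∷ r

runs : BinStr → List Run
runs [] = []
runs (b ∷ s) = consRun b (runs s)

OkFollow : Run → Run → Set
OkFollow (false , _) _ = ⊤
OkFollow (true , k) (false , m) = k < m
OkFollow (true , k) (true , m) = ⊥

OkRunsLin : List Run → Set
OkRunsLin [] = ⊤
OkRunsLin ((false , _) ∷ []) = ⊤
OkRunsLin ((true , _) ∷ []) = ⊥
OkRunsLin (x ∷ y ∷ r) = OkFollow x y × OkRunsLin (y ∷ r)

RunConstrained : Pred BinStr 0ℓ
RunConstrained s = OkRunsLin (runs s)

-- Circular runs: if the string has at least two runs and the first and
-- last runs have the same bit, they merge into one run when the string
-- is read circularly.
lastRun : Run → List Run → Run
lastRun x [] = x
lastRun x (y ∷ r) = lastRun y r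

initRuns : Run → List Run → List Run
initRuns x [] = []
initRuns x (y ∷ r) = x ∷ initRuns y r

circRuns : List Run → List Run
circRuns [] = []
circRuns (x ∷ []) = x ∷ []
circRuns ((b , k) ∷ y ∷ r) with lastRun y r
... | (c , m) with b ≟ᵇ c
...   | yes _ = (b , k + m) ∷ initRuns y r
...   | no  _ = (b , k) ∷ y ∷ r

OkPairsUpTo : Run → List Run → Set
OkPairsUpTo f [] = ⊤
OkPairsUpTo f (x ∷ []) = OkFollow x f
OkPairsUpTo f (x ∷ y ∷ r) = OkFollow x y × OkPairsUpTo f (y ∷ r)

OkRunsCirc : List Run → Set
OkRunsCirc [] = ⊤
OkRunsCirc (x ∷ r) = OkPairsUpTo x (x ∷ r)

CircRunConstrained : Pred BinStr 0ℓ
CircRunConstrained s = OkRunsCirc (circRuns (runs s))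

RlVertex : ℕ → Pred BinStr 0ℓ
RlVertex n s = length s ≡ n
             × CircRunConstrained (s ++ false ∷ [])
             × RunConstrained (s ++ false ∷ false ∷ [])

ℳ : Pred BinStr 0ℓ
ℳ = RunConstrained

ℳˡ : Pred BinStr 0ℓ
ℳˡ w = ∃[ n ] ∃[ s ] (s ∈ RlVertex n × w ≡ s ++ false ∷ false ∷ [])

0·_ : Pred BinStr 0ℓ → Pred BinStr 0ℓ
(0· F) w = ∃[ s ] (s ∈ F × w ≡ false ∷ s)

_·0 : Pred BinStr 0ℓ → Pred BinStr 0ℓ
(F ·0) w = ∃[ s ] (s ∈ F × w ≡ s ++ false ∷ [])

0·_·0 : Pred BinStr 0ℓ → Pred BinStr 0ℓ
(0· F ·0) w = ∃[ s ] (s ∈ F × w ≡ false ∷ s ++ false ∷ [])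

{-# OPTIONS --safe #-}
-- Split a vertex s of R_n^l by its first bit. If s = 1u, the string s0 begins with a 1-run and
-- ends with a 0-run, so reading it circularly merges nothing: s0 is circular-run-constrained iff
-- it is run-constrained, and then so is s00. If s = 0u, the circular reading of s0 merges its
-- first and last 0-runs into a run longer than the final 0-run of s00, so it suffices that s00
-- is run-constrained. Conversely, a run-constrained string of length at least two ends in 00
-- (a final 10 would need a longer 0-run after its 1), which recovers s from 0t ∈ 0ℳ; and a word
-- of ℳ0 outside 0ℳ0 begins with 1.
module Submission where

open import Defs
open import Level using (0ℓ)
open import Data.Bool using (Bool; true; false)
open import Data.Empty as Empty using (⊥-elim)
open import Data.Nat using (suc; _+_; _<_; s≤s; z≤n)
open import Data.Nat.Properties using (<⇒≤; m<n⇒m<1+n; <-≤-trans; m<n+m)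
open import Data.List using (List; []; _∷_; _++_; _∷ʳ_; initLast; _∷ʳ′_)
open import Data.List.Properties using (++-assoc; ++-conicalʳ; ∷-injectiveʳ)
open import Data.Product using (_×_; _,_; proj₁; proj₂; ∃-syntax; map₁; map₂)
open import Data.Sum using (inj₁; inj₂; [_,_])
open import Data.Unit using (tt)
open import Function using (_∘_; _⇔_; mk⇔; Equivalence)
open import Relation.Nullary using (¬_)
open import Relation.Unary using (Pred; _⊆_; _≐_; _∪_; _∖_; _⊥_; ｛_｝)
open import Relation.Binary.PropositionalEquality using (_≡_; refl; cong; sym; trans; subst; module ≡-Reasoning)

open Equivalence using (to; from)

appendToRun : Bool → Run → List Run
appendToRun true  (true  , k) = (true , suc k) ∷ []
appendToRun false (false , k) = (false , suc k) ∷ []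
appendToRun true  (false , k) = (false , k) ∷ (true , 1) ∷ []
appendToRun false (true  , k) = (true , k) ∷ (false , 1) ∷ []

snocRun : Bool → List Run → List Run
snocRun b []          = (b , 1) ∷ []
snocRun b (x ∷ [])    = appendToRun b x
snocRun b (x ∷ y ∷ r) = x ∷ snocRun b (y ∷ r)

consRun-snocRun : ∀ a b R → consRun a (snocRun b R) ≡ snocRun b (consRun a R)
consRun-snocRun false false []                    = refl
consRun-snocRun false true  []                    = refl
consRun-snocRun true  false []                    = refl
consRun-snocRun true  true  []                    = refl
consRun-snocRun false false ((false , _) ∷ [])    = refl
consRun-snocRun false false ((true  , _) ∷ [])    = refl
consRun-snocRun false true  ((false , _) ∷ [])    = refl
consRun-snocRun false true  ((true  , _) ∷ [])    = refl
consRun-snocRun true  false ((false , _) ∷ [])    = refl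
consRun-snocRun true  false ((true  , _) ∷ [])    = refl
consRun-snocRun true  true  ((false , _) ∷ [])    = refl
consRun-snocRun true  true  ((true  , _) ∷ [])    = refl
consRun-snocRun false _     ((false , _) ∷ _ ∷ _) = refl
consRun-snocRun false _     ((true  , _) ∷ _ ∷ _) = refl
consRun-snocRun true  _     ((false , _) ∷ _ ∷ _) = refl
consRun-snocRun true  _     ((true  , _) ∷ _ ∷ _) = refl

runs-∷ʳ : ∀ s b → runs (s ∷ʳ b) ≡ snocRun b (runs s)
runs-∷ʳ []      b = refl
runs-∷ʳ (a ∷ s) b = trans (cong (consRun a) (runs-∷ʳ s b)) (consRun-snocRun a b (runs s))

OkRunsLin-∷∷⁻ : ∀ x y r → OkRunsLin (x ∷ y ∷ r) → OkFollow x y × OkRunsLin (y ∷ r)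
OkRunsLin-∷∷⁻ (false , _) _ _ h = h
OkRunsLin-∷∷⁻ (true  , _) _ _ h = h

OkRunsLin-∷∷⁺ : ∀ x y r → OkFollow x y × OkRunsLin (y ∷ r) → OkRunsLin (x ∷ y ∷ r)
OkRunsLin-∷∷⁺ (false , _) _ _ h = h
OkRunsLin-∷∷⁺ (true  , _) _ _ h = h

OkRunsLin-tail : ∀ x r → OkRunsLin (x ∷ r) → OkRunsLin r
OkRunsLin-tail _ []      _ = tt
OkRunsLin-tail x (y ∷ r) h = proj₂ (OkRunsLin-∷∷⁻ x y r h)

OkFollow-pred : ∀ c k y → OkFollow (c , suc k) y → OkFollow (c , k) y
OkFollow-pred false _ _           _ = tt
OkFollow-pred true  _ (false , _) h = <⇒≤ h

OkRunsLin-headPred : ∀ c k r → OkRunsLin ((c , suc k) ∷ r) → OkRunsLin ((c , k) ∷ r)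
OkRunsLin-headPred false _ []      _ = tt
OkRunsLin-headPred c     k (y ∷ r) h =
  OkRunsLin-∷∷⁺ _ y r (map₁ (OkFollow-pred c k y) (OkRunsLin-∷∷⁻ _ y r h))

OkRunsLin-consRun⁻ : ∀ b R → OkRunsLin (consRun b R) → OkRunsLin R
OkRunsLin-consRun⁻ _     []                _ = tt
OkRunsLin-consRun⁻ false ((false , k) ∷ r) h = OkRunsLin-headPred false k r h
OkRunsLin-consRun⁻ true  ((true  , k) ∷ r) h = OkRunsLin-headPred true  k r h
OkRunsLin-consRun⁻ false ((true  , _) ∷ _) h = proj₂ h
OkRunsLin-consRun⁻ true  ((false , _) ∷ _) h = proj₂ h

OkRunsLin-consRun-false : ∀ R → OkRunsLin R → OkRunsLin (consRun false R)
OkRunsLin-consRun-false []                    _ = tt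
OkRunsLin-consRun-false ((false , _) ∷ [])    _ = tt
OkRunsLin-consRun-false ((false , _) ∷ _ ∷ _) h = h
OkRunsLin-consRun-false ((true  , _) ∷ _)     h = tt , h

OkRunsLin-snocRun-false : ∀ R → OkRunsLin R → OkRunsLin (snocRun false R)
OkRunsLin-snocRun-false []                                 _          = tt
OkRunsLin-snocRun-false ((false , _) ∷ [])                 _          = tt
OkRunsLin-snocRun-false ((false , _) ∷ (false , _) ∷ [])   _          = tt , tt
OkRunsLin-snocRun-false ((true  , _) ∷ (false , _) ∷ [])   (k<m , _)  = m<n⇒m<1+n k<m , tt
OkRunsLin-snocRun-false ((false , _) ∷ (true  , _) ∷ [])   (_ , ())
OkRunsLin-snocRun-false (x ∷ y ∷ z ∷ r) h =
  OkRunsLin-∷∷⁺ x y _ (map₂ (OkRunsLin-snocRun-false (y ∷ z ∷ r)) (OkRunsLin-∷∷⁻ x y _ h))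

RunConstrained-tail : ∀ b s → RunConstrained (b ∷ s) → RunConstrained s
RunConstrained-tail b s = OkRunsLin-consRun⁻ b (runs s)

RunConstrained-0∷ : ∀ s → RunConstrained s → RunConstrained (false ∷ s)
RunConstrained-0∷ s = OkRunsLin-consRun-false (runs s)

RunConstrained-∷ʳ0 : ∀ s → RunConstrained s → RunConstrained (s ∷ʳ false)
RunConstrained-∷ʳ0 s h = subst OkRunsLin (sym (runs-∷ʳ s false)) (OkRunsLin-snocRun-false (runs s) h)

RunConstrained-endsIn0 : ∀ b s → RunConstrained (b ∷ s) → ∃[ t ] b ∷ s ≡ t ∷ʳ false
RunConstrained-endsIn0 false []      _ = [] , refl
RunConstrained-endsIn0 true  []      ()
RunConstrained-endsIn0 b     (c ∷ s) h =
  let t , eq = RunConstrained-endsIn0 c s (RunConstrained-tail b (c ∷ s) h) in b ∷ t , cong (b ∷_) eq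

¬RunConstrained-endsIn10 : ∀ s → ¬ RunConstrained (s ∷ʳ true ∷ʳ false)
¬RunConstrained-endsIn10 []      (s≤s () , _)
¬RunConstrained-endsIn10 (b ∷ s) h = ¬RunConstrained-endsIn10 s (RunConstrained-tail b (s ∷ʳ true ∷ʳ false) h)

RunConstrained-endsIn00 : ∀ b c s → RunConstrained (b ∷ c ∷ s) → ∃[ t ] b ∷ c ∷ s ≡ t ++ false ∷ false ∷ []
RunConstrained-endsIn00 b c s h with RunConstrained-endsIn0 b (c ∷ s) h
... | t , eq with initLast t
...   | u ∷ʳ′ true  = ⊥-elim (¬RunConstrained-endsIn10 u (subst RunConstrained eq h))
...   | u ∷ʳ′ false = u , trans eq (++-assoc u _ _)

EndsInZeroRun : List Run → Set
EndsInZeroRun []      = Empty.⊥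
EndsInZeroRun (x ∷ r) = proj₁ (lastRun x r) ≡ false

EndsInZeroRun-∷ : ∀ x R → EndsInZeroRun R → EndsInZeroRun (x ∷ R)
EndsInZeroRun-∷ _ (_ ∷ _) e = e

EndsInZeroRun-snocRun-false : ∀ R → EndsInZeroRun (snocRun false R)
EndsInZeroRun-snocRun-false []                 = refl
EndsInZeroRun-snocRun-false ((false , _) ∷ []) = refl
EndsInZeroRun-snocRun-false ((true  , _) ∷ []) = refl
EndsInZeroRun-snocRun-false (x ∷ y ∷ r)        =
  EndsInZeroRun-∷ x (snocRun false (y ∷ r)) (EndsInZeroRun-snocRun-false (y ∷ r))

OkPairsUpTo⇔OkRunsLin : ∀ f R → EndsInZeroRun R → OkPairsUpTo f R ⇔ OkRunsLin R
OkPairsUpTo⇔OkRunsLin f ((false , _) ∷ []) _ = mk⇔ _ _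
OkPairsUpTo⇔OkRunsLin f (x ∷ y ∷ r)        e =
  let ih = OkPairsUpTo⇔OkRunsLin f (y ∷ r) e in
  mk⇔ (OkRunsLin-∷∷⁺ x y r ∘ map₂ (to ih)) (map₂ (from ih) ∘ OkRunsLin-∷∷⁻ x y r)

circRuns-1∷ : ∀ k y r → EndsInZeroRun (y ∷ r) → circRuns ((true , k) ∷ y ∷ r) ≡ (true , k) ∷ y ∷ r
circRuns-1∷ k y r e with lastRun y r
... | false , _ = refl

OkRunsCirc⇔OkRunsLin-1∷ : ∀ k y r → EndsInZeroRun (y ∷ r) →
  OkRunsCirc (circRuns ((true , k) ∷ y ∷ r)) ⇔ OkRunsLin ((true , k) ∷ y ∷ r)
OkRunsCirc⇔OkRunsLin-1∷ k y r e rewrite circRuns-1∷ k y r e =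
  OkPairsUpTo⇔OkRunsLin (true , k) ((true , k) ∷ y ∷ r) e

OkRunsCirc⇔OkRunsLin-consRun-true : ∀ R → EndsInZeroRun R →
  OkRunsCirc (circRuns (consRun true R)) ⇔ OkRunsLin (consRun true R)
OkRunsCirc⇔OkRunsLin-consRun-true ((true  , j) ∷ y ∷ r) = OkRunsCirc⇔OkRunsLin-1∷ (suc j) y r
OkRunsCirc⇔OkRunsLin-consRun-true ((false , j) ∷ r)     = OkRunsCirc⇔OkRunsLin-1∷ 1 (false , j) r

CircRunConstrained⇔RunConstrained-1…0 : ∀ u →
  CircRunConstrained (true ∷ u ∷ʳ false) ⇔ RunConstrained (true ∷ u ∷ʳ false)
CircRunConstrained⇔RunConstrained-1…0 u rewrite runs-∷ʳ u false =
  OkRunsCirc⇔OkRunsLin-consRun-true (snocRun false (runs u)) (EndsInZeroRun-snocRun-false (runs u))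

OkPairsUpTo-∷0 : ∀ f n L → OkPairsUpTo f L → OkPairsUpTo f ((false , n) ∷ L)
OkPairsUpTo-∷0 _ _ []      _ = tt
OkPairsUpTo-∷0 _ _ (_ ∷ _) h = tt , h

OkPairsUpTo-initRuns : ∀ y r m n → lastRun y r ≡ (false , m) → m < n →
  OkRunsLin (snocRun false (y ∷ r)) → OkPairsUpTo (false , n) (initRuns y r)
OkPairsUpTo-initRuns _           []          _ _ _    _   _           = tt
OkPairsUpTo-initRuns (false , _) (_ ∷ [])    _ _ refl _   _           = tt
OkPairsUpTo-initRuns (true  , _) (_ ∷ [])    _ _ refl m<n (k<1+m , _) = <-≤-trans k<1+m m<n
OkPairsUpTo-initRuns y           (z ∷ w ∷ r) m n e    m<n h           =
  map₂ (OkPairsUpTo-initRuns z (w ∷ r) m n e m<n) (OkRunsLin-∷∷⁻ y z _ h)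

OkRunsCirc-0∷ : ∀ k y r → EndsInZeroRun (y ∷ r) →
  OkRunsLin (snocRun false ((false , suc k) ∷ y ∷ r)) → OkRunsCirc (circRuns ((false , suc k) ∷ y ∷ r))
OkRunsCirc-0∷ k y r e h with lastRun y r in eq
... | false , m = OkPairsUpTo-∷0 (false , suc k + m) (suc k + m) (initRuns y r)
  (OkPairsUpTo-initRuns y r m (suc k + m) eq (m<n+m m (s≤s z≤n)) (OkRunsLin-tail _ _ h))

OkRunsCirc-consRun-false : ∀ R → EndsInZeroRun R →
  OkRunsLin (snocRun false (consRun false R)) → OkRunsCirc (circRuns (consRun false R))
OkRunsCirc-consRun-false ((false , _) ∷ [])    _ _ = tt
OkRunsCirc-consRun-false ((false , j) ∷ y ∷ r) e h = OkRunsCirc-0∷ j y r e h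
OkRunsCirc-consRun-false ((true  , j) ∷ r)     e h = OkRunsCirc-0∷ 0 (true , j) r e h

RunConstrained⇒CircRunConstrained-0…0 : ∀ u →
  RunConstrained (false ∷ u ++ false ∷ false ∷ []) → CircRunConstrained (false ∷ u ∷ʳ false)
RunConstrained⇒CircRunConstrained-0…0 u h rewrite runs-∷ʳ u false =
  OkRunsCirc-consRun-false (snocRun false (runs u)) (EndsInZeroRun-snocRun-false (runs u))
    (subst OkRunsLin runs-0u00 h)
  where
  open ≡-Reasoning
  runs-0u00 : runs (false ∷ u ++ false ∷ false ∷ []) ≡ snocRun false (consRun false (snocRun false (runs u)))
  runs-0u00 = begin
    runs (false ∷ u ++ false ∷ false ∷ [])
      ≡⟨ cong (runs ∘ (false ∷_)) (sym (++-assoc u _ _)) ⟩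
    runs (false ∷ u ∷ʳ false ∷ʳ false)
      ≡⟨ runs-∷ʳ (false ∷ u ∷ʳ false) false ⟩
    snocRun false (consRun false (runs (u ∷ʳ false)))
      ≡⟨ cong (snocRun false ∘ consRun false) (runs-∷ʳ u false) ⟩
    snocRun false (consRun false (snocRun false (runs u))) ∎

ℳˡ-0∷ : ∀ s → RunConstrained (false ∷ s ++ false ∷ false ∷ []) → ℳˡ (false ∷ s ++ false ∷ false ∷ [])
ℳˡ-0∷ s h = _ , false ∷ s , (refl , RunConstrained⇒CircRunConstrained-0…0 s h , h) , refl

ℳˡ-1∷ : ∀ u → RunConstrained (true ∷ u ∷ʳ false) → ℳˡ (true ∷ u ∷ʳ false ∷ʳ false)
ℳˡ-1∷ u h = _ , true ∷ u , (refl , circ , subst RunConstrained u00 (RunConstrained-∷ʳ0 (true ∷ u ∷ʳ false) h)) , u00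
  where
  circ : CircRunConstrained (true ∷ u ∷ʳ false)
  circ = from (CircRunConstrained⇔RunConstrained-1…0 u) h
  u00 : true ∷ u ∷ʳ false ∷ʳ false ≡ true ∷ u ++ false ∷ false ∷ []
  u00 = cong (true ∷_) (++-assoc u _ _)

-- The two parts of the right-hand side: they turn out to be the words of ℳˡ beginning with 0, resp. 1.
ℳˡ₀ ℳˡ₁ : Pred BinStr 0ℓ
ℳˡ₀ = (0· ℳ) ∖ ｛ false ∷ [] ｝
ℳˡ₁ = ((ℳ ·0) ∖ ｛ false ∷ [] ｝) ∖ (0· ℳ ·0)

ℳˡ⊆ℳˡ₀∪ℳˡ₁ : ℳˡ ⊆ ℳˡ₀ ∪ ℳˡ₁
ℳˡ⊆ℳˡ₀∪ℳˡ₁ (_ , []        , _           , refl) = inj₁ ((false ∷ [] , tt , refl) , λ ())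
ℳˡ⊆ℳˡ₀∪ℳˡ₁ (_ , false ∷ u , (_ , _ , h) , refl) =
  inj₁ ((u ++ false ∷ false ∷ [] , RunConstrained-tail false (u ++ false ∷ false ∷ []) h , refl) , [0]≢0∷u00)
  where
  [0]≢0∷u00 : ¬ false ∷ [] ≡ false ∷ u ++ false ∷ false ∷ []
  [0]≢0∷u00 eq with () ← ++-conicalʳ u _ (sym (∷-injectiveʳ eq))
ℳˡ⊆ℳˡ₀∪ℳˡ₁ (_ , true ∷ u  , (_ , c , _) , refl) =
  inj₂ (((true ∷ u ∷ʳ false , lin , cong (true ∷_) (sym (++-assoc u _ _))) , λ ()) , λ ())
  where
  lin : RunConstrained (true ∷ u ∷ʳ false)
  lin = to (CircRunConstrained⇔RunConstrained-1…0 u) c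

ℳˡ₀⊆ℳˡ : ℳˡ₀ ⊆ ℳˡ
ℳˡ₀⊆ℳˡ (([]          , _ , refl) , ≢[0]) = ⊥-elim (≢[0] refl)
ℳˡ₀⊆ℳˡ ((false ∷ []  , _ , refl) , _)    = 0 , [] , (refl , tt , tt) , refl
ℳˡ₀⊆ℳˡ ((b ∷ c ∷ t   , h , refl) , _)    =
  let s , eq = RunConstrained-endsIn00 b c t h
      0∷eq   = cong (false ∷_) eq
  in subst ℳˡ (sym 0∷eq) (ℳˡ-0∷ s (subst RunConstrained 0∷eq (RunConstrained-0∷ (b ∷ c ∷ t) h)))

ℳˡ₁⊆ℳˡ : ℳˡ₁ ⊆ ℳˡ
ℳˡ₁⊆ℳˡ ((([]        , _ , refl) , ≢[0]) , _)    = ⊥-elim (≢[0] refl)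
ℳˡ₁⊆ℳˡ (((false ∷ v , h , refl) , _)    , ∉0ℳ0) = ⊥-elim (∉0ℳ0 (v , RunConstrained-tail false v h , refl))
ℳˡ₁⊆ℳˡ (((true ∷ t  , h , refl) , _)    , _) with RunConstrained-endsIn0 true t h
... | true ∷ u , refl = ℳˡ-1∷ u h

ℳˡ₀⊥ℳˡ₁ : ℳˡ₀ ⊥ ℳˡ₁
ℳˡ₀⊥ℳˡ₁ ((_ , ≢[0]) , (([]        , _ , refl) , _) , _)    = ≢[0] refl
ℳˡ₀⊥ℳˡ₁ (_          , ((false ∷ v , h , refl) , _) , ∉0ℳ0) = ∉0ℳ0 (v , RunConstrained-tail false v h , refl)

mainTheorem5 : (ℳˡ ≐ ((0· ℳ) ∖ ｛ false ∷ [] ｝) ∪ (((ℳ ·0) ∖ ｛ false ∷ [] ｝) ∖ (0· ℳ ·0))) × (((0· ℳ) ∖ ｛ false ∷ [] ｝) ⊥ (((ℳ ·0) ∖ ｛ false ∷ [] ｝) ∖ (0· ℳ ·0)))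
mainTheorem5 = (ℳˡ⊆ℳˡ₀∪ℳˡ₁ , [ ℳˡ₀⊆ℳˡ , ℳˡ₁⊆ℳˡ ]) , ℳˡ₀⊥ℳˡ₁
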